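{- Let $K_n$ be the complete graph on vertex set $V$, let $w:V\to\mathbb{R}$, let $v\in V$ and let $A=\mathrm{Aut}(K_n)$. There is a non trivial constant $2$-labelling of $K_n$ (with respect to $w$, $v$, $A$) if and only if $w(v_1)=w(v_2)$ for all $v_1,v_2\in V\setminus\{v\}$.
   Context: Given a graph $G=(V,E)$, a vertex $v$, a weight map $w:V\to\mathbb{R}$ and a subset $A\subseteq\mathrm{Aut}(G)$, a constant $2$-labelling is a map $\varphi:V\to\{\bullet,\circ\}$ such that $\sum_{\{u\in V\mid \varphi\circ\xi(u)=\bullet\}} w(u)$ takes the same value for all $\xi\in A$ with $\varphi(\xi(v))=\bullet$, and takes the same value for all $\xi\in A$ with $\varphi(\xi(v))=\circ$. A constant $2$-labelling is trivial if it is monochromatic (all vertices have the same color), and non trivial otherwise. -}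

module Defs where

open import Level using (Level; _⊔_; suc)
open import Data.Nat using (ℕ)
open import Data.Fin using (Fin)
open import Data.Unit using (⊤)
open import Data.Fin.Permutation using (Permutation′; _⟨$⟩ʳ_)
open import Data.Product using (Σ; ∃; _×_)
open import Relation.Binary.PropositionalEquality using (_≡_; _≢_)
open import Relation.Nullary using (¬_)
open import Function.Bundles using (_⇔_)
open import Algebra.Bundles using (AbelianGroup)
import Algebra.Properties.CommutativeMonoid.Sum as CMSum

record Graph (n : ℕ) : Set₁ where
  field
    Adj : Fin n → Fin n → Set

K : (n : ℕ) → Graph n
K n = record { Adj = λ u v → u ≢ v }

IsAut : ∀ {n} → Graph n → Permutation′ n → Set
IsAut G σ = ∀ u v → Graph.Adj G u v ⇔ Graph.Adj G (σ ⟨$⟩ʳ u) (σ ⟨$⟩ʳ v)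

Aut : ∀ {n} → Graph n → Set
Aut {n} G = Σ (Permutation′ n) (IsAut G)

data Colour : Set where
  black white : Colour

module _ {c ℓ : Level} (M : AbelianGroup c ℓ) where
  open AbelianGroup M
  open CMSum commutativeMonoid using (sum)

  blackWeight : ∀ {n} → (Fin n → Carrier) → (Fin n → Colour) → Permutation′ n → Carrier
  blackWeight w φ ξ = sum (λ u → pick (φ (ξ ⟨$⟩ʳ u)) (w u))
    where
    pick : Colour → Carrier → Carrier
    pick black x = x
    pick white x = ε

  IsConstant2Labelling : ∀ {n} (G : Graph n) (w : Fin n → Carrier) (v : Fin n)
    (A : Aut G → Set) (φ : Fin n → Colour) → Set ℓ
  IsConstant2Labelling G w v A φ =
    ∀ (ξ ξ′ : Aut G) → A ξ → A ξ′ → (col : Colour) →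
      φ (Σ.proj₁ ξ ⟨$⟩ʳ v) ≡ col → φ (Σ.proj₁ ξ′ ⟨$⟩ʳ v) ≡ col →
      blackWeight w φ (Σ.proj₁ ξ) ≈ blackWeight w φ (Σ.proj₁ ξ′)

Trivial : ∀ {n} → (Fin n → Colour) → Set
Trivial {n} φ = ∃ λ (col : Colour) → ∀ (u : Fin n) → φ u ≡ col

NonTrivial : ∀ {n} → (Fin n → Colour) → Set
NonTrivial φ = ¬ Trivial φ

AllAut : ∀ {n} (G : Graph n) → Aut G → Set
AllAut G _ = ⊤

-- A non-trivial labelling φ can be moved by an automorphism ρ so that φ ∘ ρ colours any two
-- vertices v₁ ≠ v₂ other than v black and white respectively. Precomposing ρ with the
-- transposition (v₁ v₂) fixes v, so constancy equates two black weights that differ only by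
-- exchanging w v₁ for w v₂; cancelling gives w v₁ = w v₂. Conversely, if v alone is black, the
-- black weight of ξ is w (ξ⁻¹ v): this is w v when ξ fixes v, and otherwise a weight of a
-- vertex other than v, all of which are equal by hypothesis.
module Submission where

open import Defs
open import Level using (Level)
open import Data.Nat using (ℕ; _≥_; s≤s; z≤n)
open import Data.Fin using (Fin; zero; suc; punchIn)
open import Data.Fin.Properties using (_≟_; punchInᵢ≢i; ¬∀⟶∃¬)
open import Data.Fin.Permutation
  using (Permutation′; _⟨$⟩ʳ_; _⟨$⟩ˡ_; transpose; flip; _∘ₚ_; inverseˡ; inverseʳ)
import Data.Fin.Permutation.Components as PC
open import Data.Product using (Σ; ∃; _×_; _,_)
open import Data.Empty using (⊥-elim)
open import Data.Unit using (tt)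
open import Data.Bool using (if_then_else_)
open import Relation.Nullary using (Dec; yes; no; does)
open import Relation.Nullary.Decidable using (dec-true; dec-false)
open import Relation.Binary.PropositionalEquality
  using (_≡_; _≢_; refl; sym; trans; cong)
open import Function.Base using (_∘_)
open import Function.Bundles using (_⇔_; mk⇔; Injection)
open import Function.Properties.Inverse using (↔⇒↣)
open import Algebra.Bundles using (AbelianGroup)
import Algebra.Properties.CommutativeMonoid.Sum as CommutativeMonoidSum
import Algebra.Properties.Group as GroupProperties
import Relation.Binary.Reasoning.Setoid as SetoidReasoning

transpose-matchˡ : ∀ {n} (i j : Fin n) → PC.transpose i j i ≡ j
transpose-matchˡ i j rewrite dec-true (i ≟ i) refl = refl

transpose-other : ∀ {n} {i j k : Fin n} → k ≢ i → k ≢ j → PC.transpose i j k ≡ k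
transpose-other {i = i} {j} {k} k≢i k≢j
  rewrite dec-false (k ≟ i) k≢i | dec-false (k ≟ j) k≢j = refl

permutation-injective : ∀ {n} (π : Permutation′ n) {a b : Fin n} →
  π ⟨$⟩ʳ a ≡ π ⟨$⟩ʳ b → a ≡ b
permutation-injective π = Injection.injective (↔⇒↣ π)

fixedʳ⇒fixedˡ : ∀ {n} (π : Permutation′ n) {v : Fin n} → π ⟨$⟩ʳ v ≡ v → π ⟨$⟩ˡ v ≡ v
fixedʳ⇒fixedˡ π {v} πv≡v = permutation-injective π (trans (inverseʳ π) (sym πv≡v))

-- The composite moves i to a and then the image of j to b without touching a.
permutation-2-transitive : ∀ {n} {i j a b : Fin n} → i ≢ j → a ≢ b →
  Σ (Permutation′ n) λ ρ → ρ ⟨$⟩ʳ i ≡ a × ρ ⟨$⟩ʳ j ≡ b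
permutation-2-transitive {i = i} {j} {a} {b} i≢j a≢b =
  transpose i a ∘ₚ transpose y b ,
  trans (cong (PC.transpose y b) (transpose-matchˡ i a)) (transpose-other a≢y a≢b) ,
  transpose-matchˡ y b
  where
  y : Fin _
  y = PC.transpose i a j
  a≢y : a ≢ y
  a≢y a≡y = i≢j (permutation-injective (transpose i a) (trans (transpose-matchˡ i a) a≡y))

permutation-isAut-K : ∀ {n} (π : Permutation′ n) → IsAut (K n) π
permutation-isAut-K π u v =
  mk⇔ (λ u≢v → u≢v ∘ permutation-injective π) (λ πu≢πv → πu≢πv ∘ cong (π ⟨$⟩ʳ_))

fin-other : ∀ {n} → n ≥ 2 → (v : Fin n) → ∃ λ u → u ≢ v
fin-other (s≤s (s≤s z≤n)) zero    = suc zero , λ ()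
fin-other (s≤s (s≤s z≤n)) (suc _) = zero , λ ()

black≢white : black ≢ white
black≢white ()

_≟ᶜ_ : (c d : Colour) → Dec (c ≡ d)
black ≟ᶜ black = yes refl
black ≟ᶜ white = no λ ()
white ≟ᶜ black = no λ ()
white ≟ᶜ white = yes refl

≢black⇒≡white : ∀ {c} → c ≢ black → c ≡ white
≢black⇒≡white {black} c≢black = ⊥-elim (c≢black refl)
≢black⇒≡white {white} _       = refl

≢white⇒≡black : ∀ {c} → c ≢ white → c ≡ black
≢white⇒≡black {black} _       = refl
≢white⇒≡black {white} c≢white = ⊥-elim (c≢white refl)

nonTrivial⇒black×white : ∀ {n} (φ : Fin n → Colour) → NonTrivial φ →
  (∃ λ B → φ B ≡ black) × (∃ λ W → φ W ≡ white)
nonTrivial⇒black×white {n} φ nonTrivial with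
  ¬∀⟶∃¬ n (λ u → φ u ≡ white) (λ u → φ u ≟ᶜ white) (λ all → nonTrivial (white , all)) |
  ¬∀⟶∃¬ n (λ u → φ u ≡ black) (λ u → φ u ≟ᶜ black) (λ all → nonTrivial (black , all))
... | B , B≢white | W , W≢black = (B , ≢white⇒≡black B≢white) , (W , ≢black⇒≡white W≢black)

differentColours⇒≢ : ∀ {n} (φ : Fin n → Colour) {B W : Fin n} →
  φ B ≡ black → φ W ≡ white → B ≢ W
differentColours⇒≢ φ B-black W-white refl = black≢white (trans (sym B-black) W-white)

nonTrivial⇒separating : ∀ {n} (φ : Fin n → Colour) → NonTrivial φ → {i j : Fin n} → i ≢ j →
  Σ (Permutation′ n) λ ρ → φ (ρ ⟨$⟩ʳ i) ≡ black × φ (ρ ⟨$⟩ʳ j) ≡ white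
nonTrivial⇒separating φ nonTrivial i≢j with nonTrivial⇒black×white φ nonTrivial
... | (B , B-black) , (W , W-white)
    with permutation-2-transitive i≢j (differentColours⇒≢ φ B-black W-white)
...   | ρ , ρi≡B , ρj≡W = ρ , trans (cong φ ρi≡B) B-black , trans (cong φ ρj≡W) W-white

blackOnly : ∀ {n} → Fin n → Fin n → Colour
blackOnly v u = if does (u ≟ v) then black else white

blackOnly-self : ∀ {n} (v : Fin n) → blackOnly v v ≡ black
blackOnly-self v rewrite dec-true (v ≟ v) refl = refl

blackOnly-other : ∀ {n} {v u : Fin n} → u ≢ v → blackOnly v u ≡ white
blackOnly-other {v = v} {u} u≢v rewrite dec-false (u ≟ v) u≢v = refl

blackOnly-black⇒≡ : ∀ {n} {v u : Fin n} → blackOnly v u ≡ black → u ≡ v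
blackOnly-black⇒≡ {v = v} {u} eq with u ≟ v
... | yes u≡v = u≡v
... | no  _   = ⊥-elim (black≢white (sym eq))

module _ {c ℓ : Level} (M : AbelianGroup c ℓ) where
  open AbelianGroup M
    using (Carrier; _≈_; _∙_; ε; setoid; commutativeMonoid; group; assoc; comm;
           ∙-cong; ∙-congˡ; ∙-congʳ; identityˡ; identityʳ; reflexive)
    renaming (refl to ≈-refl; sym to ≈-sym; trans to ≈-trans)
  open CommutativeMonoidSum commutativeMonoid
    using (sum; sum-remove; sum-cong-≋; sum-cong-≗; sum-permute; sum-replicate-zero)
  open GroupProperties group using (∙-cancelʳ)
  open SetoidReasoning setoid

  ifBlack : Colour → Carrier → Carrier
  ifBlack black x = x
  ifBlack white _ = ε

  ifBlack-black : ∀ {c} x → c ≡ black → ifBlack c x ≈ x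
  ifBlack-black x refl = ≈-refl

  ifBlack-white : ∀ {c} x → c ≡ white → ifBlack c x ≈ ε
  ifBlack-white x refl = ≈-refl

  blackSum : ∀ {n} → (Fin n → Colour) → (Fin n → Carrier) → Carrier
  blackSum col w = sum λ u → ifBlack (col u) (w u)

  -- The summand of blackWeight is local to its definition; unifying with sum recovers it.
  summandOf : ∀ {n} (s : Carrier) {f : Fin n → Carrier} → s ≡ sum f → Fin n → Carrier
  summandOf _ {f} _ = f

  blackWeight≈blackSum : ∀ {n} (w : Fin n → Carrier) (φ : Fin n → Colour) (ξ : Permutation′ n) →
    blackWeight M w φ ξ ≈ blackSum (λ u → φ (ξ ⟨$⟩ʳ u)) w
  blackWeight≈blackSum w φ ξ = sum-cong-≋ summand≈
    where
    summand≈ : ∀ u → summandOf (blackWeight M w φ ξ) refl u ≈ ifBlack (φ (ξ ⟨$⟩ʳ u)) (w u)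
    summand≈ u with φ (ξ ⟨$⟩ʳ u)
    ... | black = ≈-refl
    ... | white = ≈-refl

  sum-cong-except : ∀ {n} (f g : Fin n → Carrier) (i : Fin n) →
    (∀ u → u ≢ i → f u ≈ g u) → f i ∙ sum g ≈ g i ∙ sum f
  sum-cong-except {ℕ.suc _} f g i f≈g = begin
    f i ∙ sum g                          ≈⟨ ∙-congˡ (sum-remove {i = i} g) ⟩
    f i ∙ (g i ∙ sum (g ∘punchIn))        ≈⟨ ≈-sym (assoc _ _ _) ⟩
    (f i ∙ g i) ∙ sum (g ∘punchIn)        ≈⟨ ∙-cong (comm _ _) (≈-sym rest) ⟩
    (g i ∙ f i) ∙ sum (f ∘punchIn)        ≈⟨ assoc _ _ _ ⟩
    g i ∙ (f i ∙ sum (f ∘punchIn))        ≈⟨ ∙-congˡ (≈-sym (sum-remove {i = i} f)) ⟩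
    g i ∙ sum f                          ∎
    where
    _∘punchIn : (Fin _ → Carrier) → Fin _ → Carrier
    (h ∘punchIn) k = h (punchIn i k)
    rest : sum (f ∘punchIn) ≈ sum (g ∘punchIn)
    rest = sum-cong-≋ λ k → f≈g (punchIn i k) (punchInᵢ≢i i k)

  blackSum-single : ∀ {n} (col : Fin n → Colour) (w : Fin n → Carrier) (a : Fin n) →
    col a ≡ black → (∀ u → u ≢ a → col u ≡ white) → blackSum col w ≈ w a
  blackSum-single {n} col w a a-black others-white = begin
    blackSum col w               ≈⟨ ≈-sym (identityˡ _) ⟩
    ε ∙ blackSum col w           ≈⟨ ≈-sym (sum-cong-except f (λ _ → ε) a f≈ε) ⟩
    f a ∙ sum {n} (λ _ → ε)      ≈⟨ ∙-cong (ifBlack-black (w a) a-black) (sum-replicate-zero n) ⟩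
    w a ∙ ε                      ≈⟨ identityʳ _ ⟩
    w a                          ∎
    where
    f : Fin n → Carrier
    f u = ifBlack (col u) (w u)
    f≈ε : ∀ u → u ≢ a → f u ≈ ε
    f≈ε u u≢a = ifBlack-white (w u) (others-white u u≢a)

  blackSum-permute : ∀ {n} (col : Fin n → Colour) (w : Fin n → Carrier) (π : Permutation′ n) →
    blackSum (λ u → col (π ⟨$⟩ʳ u)) w ≈ blackSum col (λ u → w (π ⟨$⟩ˡ u))
  blackSum-permute col w π = begin
    blackSum (λ u → col (π ⟨$⟩ʳ u)) w                             ≈⟨ sum-permute _ (flip π) ⟩
    sum (λ u → ifBlack (col (π ⟨$⟩ʳ (π ⟨$⟩ˡ u))) (w (π ⟨$⟩ˡ u)))  ≡⟨ sum-cong-≗ cancel ⟩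
    blackSum col (λ u → w (π ⟨$⟩ˡ u))                             ∎
    where
    cancel : ∀ u → ifBlack (col (π ⟨$⟩ʳ (π ⟨$⟩ˡ u))) (w (π ⟨$⟩ˡ u)) ≡ ifBlack (col u) (w (π ⟨$⟩ˡ u))
    cancel u = cong (λ k → ifBlack (col k) (w (π ⟨$⟩ˡ u))) (inverseʳ π)

  -- Off i the two summands agree: they have the same weight, or (at j) are both white.
  blackSum-transpose : ∀ {n} (col : Fin n → Colour) (w : Fin n → Carrier) {i j : Fin n} →
    col i ≡ black → col j ≡ white →
    w i ∙ blackSum col (λ u → w (PC.transpose i j u)) ≈ w j ∙ blackSum col w
  blackSum-transpose col w {i} {j} i-black j-white = begin
    w i ∙ sum g                       ≈⟨ ∙-congʳ (≈-sym (ifBlack-black (w i) i-black)) ⟩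
    f i ∙ sum g                       ≈⟨ sum-cong-except f g i f≈g ⟩
    g i ∙ sum f                       ≈⟨ ∙-congʳ (ifBlack-black _ i-black) ⟩
    w (PC.transpose i j i) ∙ sum f    ≡⟨ cong (λ k → w k ∙ sum f) (transpose-matchˡ i j) ⟩
    w j ∙ sum f                       ∎
    where
    f g : Fin _ → Carrier
    f u = ifBlack (col u) (w u)
    g u = ifBlack (col u) (w (PC.transpose i j u))
    f≈g : ∀ u → u ≢ i → f u ≈ g u
    f≈g u u≢i with u ≟ j
    ... | yes refl = ≈-trans (ifBlack-white _ j-white) (≈-sym (ifBlack-white _ j-white))
    ... | no  u≢j  = reflexive (cong (λ k → ifBlack (col u) (w k)) (sym (transpose-other u≢i u≢j)))

  blackWeight-transpose : ∀ {n} (w : Fin n → Carrier) (φ : Fin n → Colour) (ρ : Permutation′ n)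
    {i j : Fin n} → φ (ρ ⟨$⟩ʳ i) ≡ black → φ (ρ ⟨$⟩ʳ j) ≡ white →
    w i ∙ blackWeight M w φ (transpose j i ∘ₚ ρ) ≈ w j ∙ blackWeight M w φ ρ
  blackWeight-transpose w φ ρ {i} {j} i-black j-white = begin
    w i ∙ blackWeight M w φ (τ ∘ₚ ρ)                   ≈⟨ ∙-congˡ (blackWeight≈blackSum w φ (τ ∘ₚ ρ)) ⟩
    w i ∙ blackSum (λ u → col (τ ⟨$⟩ʳ u)) w            ≈⟨ ∙-congˡ (blackSum-permute col w τ) ⟩
    w i ∙ blackSum col (λ u → w (PC.transpose i j u))  ≈⟨ blackSum-transpose col w i-black j-white ⟩
    w j ∙ blackSum col w                               ≈⟨ ∙-congˡ (≈-sym (blackWeight≈blackSum w φ ρ)) ⟩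
    w j ∙ blackWeight M w φ ρ                          ∎
    where
    τ : Permutation′ _
    τ = transpose j i
    col : Fin _ → Colour
    col u = φ (ρ ⟨$⟩ʳ u)

  constant2Labelling⇒equalWeights : ∀ {n} (w : Fin n → Carrier) (v : Fin n) (φ : Fin n → Colour) →
    IsConstant2Labelling M (K n) w v (AllAut (K n)) φ → NonTrivial φ →
    ∀ v₁ v₂ → v₁ ≢ v → v₂ ≢ v → w v₁ ≈ w v₂
  constant2Labelling⇒equalWeights w v φ constant nonTrivial v₁ v₂ v₁≢v v₂≢v with v₁ ≟ v₂
  ... | yes refl = ≈-refl
  ... | no v₁≢v₂ with nonTrivial⇒separating φ nonTrivial v₁≢v₂
  ...   | ρ , v₁-black , v₂-white = ∙-cancelʳ _ _ _ (begin
    w v₁ ∙ blackWeight M w φ ρ   ≈⟨ ∙-congˡ (≈-sym same-weight) ⟩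
    w v₁ ∙ blackWeight M w φ ξ   ≈⟨ blackWeight-transpose w φ ρ v₁-black v₂-white ⟩
    w v₂ ∙ blackWeight M w φ ρ   ∎)
    where
    ξ : Permutation′ _
    ξ = transpose v₂ v₁ ∘ₚ ρ
    same-weight : blackWeight M w φ ξ ≈ blackWeight M w φ ρ
    same-weight = constant (ξ , permutation-isAut-K ξ) (ρ , permutation-isAut-K ρ) tt tt _
      (cong (λ k → φ (ρ ⟨$⟩ʳ k)) (transpose-other (v₂≢v ∘ sym) (v₁≢v ∘ sym))) refl

  blackWeight-blackOnly : ∀ {n} (w : Fin n → Carrier) (v : Fin n) (ξ : Permutation′ n) →
    blackWeight M w (blackOnly v) ξ ≈ w (ξ ⟨$⟩ˡ v)
  blackWeight-blackOnly w v ξ = ≈-trans (blackWeight≈blackSum w (blackOnly v) ξ)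
    (blackSum-single _ w (ξ ⟨$⟩ˡ v) (trans (cong (blackOnly v) (inverseʳ ξ)) (blackOnly-self v))
      λ u u≢ξˡv → blackOnly-other λ ξu≡v → u≢ξˡv (trans (sym (inverseˡ ξ)) (cong (ξ ⟨$⟩ˡ_) ξu≡v)))

  blackOnly-constant2Labelling : ∀ {n} (w : Fin n → Carrier) (v : Fin n) →
    (∀ v₁ v₂ → v₁ ≢ v → v₂ ≢ v → w v₁ ≈ w v₂) →
    IsConstant2Labelling M (K n) w v (AllAut (K n)) (blackOnly v)
  blackOnly-constant2Labelling w v equal (ξ , _) (ξ′ , _) _ _ col ξv-col ξ′v-col = begin
    blackWeight M w (blackOnly v) ξ    ≈⟨ blackWeight-blackOnly w v ξ ⟩
    w (ξ ⟨$⟩ˡ v)                       ≈⟨ preimages col ξv-col ξ′v-col ⟩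
    w (ξ′ ⟨$⟩ˡ v)                      ≈⟨ ≈-sym (blackWeight-blackOnly w v ξ′) ⟩
    blackWeight M w (blackOnly v) ξ′   ∎
    where
    fixed : ∀ π → blackOnly v (π ⟨$⟩ʳ v) ≡ black → π ⟨$⟩ˡ v ≡ v
    fixed π = fixedʳ⇒fixedˡ π ∘ blackOnly-black⇒≡
    moved : ∀ π → blackOnly v (π ⟨$⟩ʳ v) ≡ white → π ⟨$⟩ˡ v ≢ v
    moved π πv-white πˡv≡v = black≢white (trans (sym (blackOnly-self v))
      (trans (cong (blackOnly v) (sym (fixedʳ⇒fixedˡ (flip π) πˡv≡v))) πv-white))
    preimages : ∀ col → blackOnly v (ξ ⟨$⟩ʳ v) ≡ col → blackOnly v (ξ′ ⟨$⟩ʳ v) ≡ col →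
      w (ξ ⟨$⟩ˡ v) ≈ w (ξ′ ⟨$⟩ˡ v)
    preimages black ξv ξ′v = reflexive (cong w (trans (fixed ξ ξv) (sym (fixed ξ′ ξ′v))))
    preimages white ξv ξ′v = equal _ _ (moved ξ ξv) (moved ξ′ ξ′v)

blackOnly-nonTrivial : ∀ {n} → n ≥ 2 → (v : Fin n) → NonTrivial (blackOnly v)
blackOnly-nonTrivial n≥2 v (col , monochrome) with fin-other n≥2 v
... | u , u≢v = black≢white (trans (sym (blackOnly-self v))
  (trans (monochrome v) (trans (sym (monochrome u)) (blackOnly-other u≢v))))

mainTheorem2 : ∀ {c ℓ : Level} (M : AbelianGroup c ℓ) (n : ℕ) → n ≥ 2 →
    (w : Fin n → AbelianGroup.Carrier M) (v : Fin n) →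
    (Σ (Fin n → Colour) λ φ →
        IsConstant2Labelling M (K n) w v (AllAut (K n)) φ × NonTrivial φ)
    ⇔ (∀ (v₁ v₂ : Fin n) → v₁ ≢ v → v₂ ≢ v → AbelianGroup._≈_ M (w v₁) (w v₂))
mainTheorem2 M n n≥2 w v = mk⇔
  (λ (φ , constant , nonTrivial) → constant2Labelling⇒equalWeights M w v φ constant nonTrivial)
  (λ equal → blackOnly v , blackOnly-constant2Labelling M w v equal , blackOnly-nonTrivial n≥2 v)
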